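{- Let $m$ be a positive integer such that a Hadamard matrix of order $m$ exists. Then there exists a balancedly splittable Hadamard matrix of order $m^2$ with parameters $(m^2,m,m,0)$.
   Context: A Hadamard matrix of order $n$ is an $n\times n$ $\{1,-1\}$-matrix $H$ with $HH^\top=nI_n$; $J_n$ is the all-ones matrix. $H$ is balancedly splittable with parameters $(n,\ell,a,b)$ if, after permuting its rows, $H=\begin{pmatrix}H_1\\H_2\end{pmatrix}$ with $H_1$ an $\ell\times n$ matrix such that $H_1^\top H_1=\ell I_n+aA+b(J_n-A-I_n)$ for a symmetric $(0,1)$-matrix $A$ with zero diagonal. -}

module Defs where

open import Data.Nat using (ℕ; zero; suc; _≤_; _*_)
open import Data.Integer using (ℤ; +_; -[1+_]; _+_) renaming (_*_ to _*ℤ_)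
open import Data.Fin using (Fin; zero; suc; inject≤)
open import Data.Fin.Permutation using (Permutation′; _⟨$⟩ʳ_)
open import Data.Product using (Σ; ∃; _×_; _,_)
open import Data.Sum using (_⊎_)
open import Relation.Binary.PropositionalEquality using (_≡_; _≢_)

Matrix : ℕ → ℕ → Set
Matrix m n = Fin m → Fin n → ℤ

Σ[<_]_ : (n : ℕ) → (Fin n → ℤ) → ℤ
Σ[< zero ] f = + 0
Σ[< suc n ] f = f zero + Σ[< n ] (λ i → f (suc i))

rowInner : ∀ {m n} → Matrix m n → Fin m → Fin m → ℤ
rowInner {n = n} M i j = Σ[< n ] (λ k → M i k *ℤ M j k)

colInner : ∀ {m n} → Matrix m n → Fin n → Fin n → ℤ
colInner {m = m} M i j = Σ[< m ] (λ k → M k i *ℤ M k j)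

IsPM1 : ∀ {m n} → Matrix m n → Set
IsPM1 M = ∀ i j → (M i j ≡ + 1) ⊎ (M i j ≡ -[1+ 0 ])

IsHadamard : (n : ℕ) → Matrix n n → Set
IsHadamard n H =
  IsPM1 H ×
  (∀ i j → (i ≡ j → rowInner H i j ≡ + n) × (i ≢ j → rowInner H i j ≡ + 0))

HadamardExists : ℕ → Set
HadamardExists n = Σ (Matrix n n) (IsHadamard n)

IsAdjacency : ∀ {n} → (Fin n → Fin n → ℕ) → Set
IsAdjacency A =
  (∀ i j → (A i j ≡ 0) ⊎ (A i j ≡ 1)) ×
  (∀ i j → A i j ≡ A j i) ×
  (∀ i → A i i ≡ 0)

-- H₁ᵀ H₁ = ℓ I + a A + b (J - A - I), stated entrywise
GramCondition : ∀ {ℓ n} → Matrix ℓ n → ℕ → ℤ → ℤ → (Fin n → Fin n → ℕ) → Set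
GramCondition H₁ ℓ a b A =
  ∀ i j → (i ≡ j → colInner H₁ i j ≡ + ℓ)
        × (i ≢ j → A i j ≡ 1 → colInner H₁ i j ≡ a)
        × (i ≢ j → A i j ≡ 0 → colInner H₁ i j ≡ b)

BalancedlySplittable : (n : ℕ) → Matrix n n → (ℓ : ℕ) → ℤ → ℤ → Set
BalancedlySplittable n H ℓ a b =
  Σ (ℓ ≤ n) λ ℓ≤n →
  Σ (Permutation′ n) λ σ →
  Σ (Fin n → Fin n → ℕ) λ A →
    IsAdjacency A ×
    GramCondition (λ k j → H (σ ⟨$⟩ʳ inject≤ k ℓ≤n) j) ℓ a b A

module Submission where

-- Index the rows and columns of K by pairs (a, b), (c, d) ∈ [m]² and put
--   K[(a,b),(c,d)] = H[c,b] · H[d,a] · H[d,0].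
-- Row inner products of K factor as (column inner product of H at b, b') times
-- (column inner product of H at a, a'), so K is Hadamard as soon as the columns
-- of H are orthogonal.  That H Hᵀ = mI forces Hᵀ H = mI is shown without
-- inverses: both Gram matrices have the same sum of squared entries, and a
-- matrix with diagonal m whose squared entries sum to m·m² has zero
-- off-diagonal part.  The top m rows (a = 0) of K are H₁[b,(c,d)] = H[c,b],
-- so H₁ᵀH₁ = m·(block diagonal of all-ones blocks): the splitting is balanced
-- with A the graph of m disjoint cliques and (a, b) = (m, 0).

open import Defs
open import Data.Nat using (ℕ; _*_; NonZero)
open import Data.Integer using (+_)
open import Data.Product using (Σ; _×_)

open import Data.Nat using (zero; suc; _+_; _≤_; z≤n)
open import Data.Nat.Properties using (m≤m*n; m+n≡0⇒m≡0; m+n≡0⇒n≡0)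
open import Data.Integer using (ℤ; -[1+_]; 0ℤ; 1ℤ; ∣_∣; +≤+)
  renaming (_+_ to _+ℤ_; _*_ to _*ℤ_; _≤_ to _≤ℤ_)
import Data.Integer.Properties as ZP
open import Data.Fin using (Fin; zero; suc; _↑ˡ_; _↑ʳ_; combine; remQuot; inject≤; punchIn; punchOut; _≟_)
import Data.Fin.Properties as FP
open import Data.Fin.Permutation using (id)
open import Data.Product using (_,_; proj₁; proj₂)
open import Data.Sum using (_⊎_; inj₁; inj₂)
open import Data.Empty using (⊥-elim)
open import Function using (_∘_)
open import Relation.Nullary using (Dec; yes; no; ¬_)
open import Relation.Nullary.Decidable using (_×-dec_; ¬?)
open import Relation.Binary.PropositionalEquality
open import Algebra.Properties.Semiring.Sum ZP.+-*-semiring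
  using (sum; ∑-distrib-+; ∑-comm; *-distribˡ-sum; *-distribʳ-sum; sum-remove)
open import Algebra.Properties.CommutativeSemigroup ZP.*-commutativeSemigroup
  using (interchange)
open import Algebra.Properties.AbelianGroup ZP.+-0-abelianGroup
  using (∙-cancelˡ)

sq : ℤ → ℤ
sq x = x *ℤ x

PlusMinusOne : ℤ → Set
PlusMinusOne x = (x ≡ + 1) ⊎ (x ≡ -[1+ 0 ])

±1-square : ∀ {x} → PlusMinusOne x → sq x ≡ 1ℤ
±1-square (inj₁ refl) = refl
±1-square (inj₂ refl) = refl

±1-mul : ∀ {x y} → PlusMinusOne x → PlusMinusOne y → PlusMinusOne (x *ℤ y)
±1-mul (inj₁ refl) (inj₁ refl) = inj₁ refl
±1-mul (inj₁ refl) (inj₂ refl) = inj₂ refl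
±1-mul (inj₂ refl) (inj₁ refl) = inj₂ refl
±1-mul (inj₂ refl) (inj₂ refl) = inj₁ refl

±1-absorb : ∀ {z} x → PlusMinusOne z → x *ℤ sq z ≡ x
±1-absorb x ±z = trans (cong (x *ℤ_) (±1-square ±z)) (ZP.*-identityʳ x)

sq-nonneg : ∀ x → 0ℤ ≤ℤ sq x
sq-nonneg (+ n) rewrite sym (ZP.pos-* n n) = +≤+ z≤n
sq-nonneg -[1+ n ] = +≤+ z≤n

sq≡0⇒≡0 : ∀ x → sq x ≡ 0ℤ → x ≡ 0ℤ
sq≡0⇒≡0 x e with ZP.i*j≡0⇒i≡0∨j≡0 x e
... | inj₁ x≡0 = x≡0
... | inj₂ x≡0 = x≡0

nonneg-sum≡0 : ∀ {x y} → 0ℤ ≤ℤ x → 0ℤ ≤ℤ y → x +ℤ y ≡ 0ℤ → (x ≡ 0ℤ) × (y ≡ 0ℤ)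
nonneg-sum≡0 {+ a} {+ b} (+≤+ _) (+≤+ _) e =
  cong +_ (m+n≡0⇒m≡0 a (cong ∣_∣ e)) , cong +_ (m+n≡0⇒n≡0 a (cong ∣_∣ e))

-- Σ[<_] (from Defs) is the recursive sum; it agrees with the library's
-- semiring sum, which lets us import the library's summation laws.
Σ≡sum : ∀ n (f : Fin n → ℤ) → Σ[< n ] f ≡ sum f
Σ≡sum zero f = refl
Σ≡sum (suc n) f = cong (f zero +ℤ_) (Σ≡sum n (f ∘ suc))

Σ-cong : ∀ n {f g : Fin n → ℤ} → (∀ i → f i ≡ g i) → Σ[< n ] f ≡ Σ[< n ] g
Σ-cong zero f≗g = refl
Σ-cong (suc n) f≗g = cong₂ _+ℤ_ (f≗g zero) (Σ-cong n (f≗g ∘ suc))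

Σ-+ : ∀ n (f g : Fin n → ℤ) → Σ[< n ] (λ i → f i +ℤ g i) ≡ Σ[< n ] f +ℤ Σ[< n ] g
Σ-+ n f g = begin
  Σ[< n ] (λ i → f i +ℤ g i) ≡⟨ Σ≡sum n _ ⟩
  sum (λ i → f i +ℤ g i)     ≡⟨ ∑-distrib-+ f g ⟩
  sum f +ℤ sum g             ≡⟨ sym (cong₂ _+ℤ_ (Σ≡sum n f) (Σ≡sum n g)) ⟩
  Σ[< n ] f +ℤ Σ[< n ] g     ∎
  where open ≡-Reasoning

Σ-*ˡ : ∀ n c (f : Fin n → ℤ) → c *ℤ Σ[< n ] f ≡ Σ[< n ] (λ i → c *ℤ f i)
Σ-*ˡ n c f = trans (cong (c *ℤ_) (Σ≡sum n f))
  (trans (*-distribˡ-sum c f) (sym (Σ≡sum n _)))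

Σ-*ʳ : ∀ n c (f : Fin n → ℤ) → Σ[< n ] f *ℤ c ≡ Σ[< n ] (λ i → f i *ℤ c)
Σ-*ʳ n c f = trans (cong (_*ℤ c) (Σ≡sum n f))
  (trans (*-distribʳ-sum c f) (sym (Σ≡sum n _)))

Σ-product : ∀ n k (f : Fin n → ℤ) (g : Fin k → ℤ) →
  Σ[< n ] f *ℤ Σ[< k ] g ≡ Σ[< n ] (λ a → Σ[< k ] (λ b → f a *ℤ g b))
Σ-product n k f g =
  trans (Σ-*ʳ n _ f) (Σ-cong n (λ a → Σ-*ˡ k (f a) g))

Σ-swap : ∀ m n (f : Fin m → Fin n → ℤ) →
  Σ[< m ] (λ i → Σ[< n ] (f i)) ≡ Σ[< n ] (λ j → Σ[< m ] (λ i → f i j))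
Σ-swap m n f = begin
  Σ[< m ] (λ i → Σ[< n ] (f i))           ≡⟨ Σ-cong m (λ i → Σ≡sum n (f i)) ⟩
  Σ[< m ] (λ i → sum (f i))               ≡⟨ Σ≡sum m _ ⟩
  sum (λ i → sum (f i))                   ≡⟨ ∑-comm f ⟩
  sum (λ j → sum (λ i → f i j))           ≡⟨ sym (Σ≡sum n _) ⟩
  Σ[< n ] (λ j → sum (λ i → f i j))       ≡⟨ sym (Σ-cong n (λ j → Σ≡sum m _)) ⟩
  Σ[< n ] (λ j → Σ[< m ] (λ i → f i j))   ∎
  where open ≡-Reasoning

Σ²-interchange : ∀ m n (X : Fin n → Fin n → Fin m → Fin m → ℤ) →
  Σ[< n ] (λ i → Σ[< n ] (λ j → Σ[< m ] (λ a → Σ[< m ] (λ b → X i j a b))))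
  ≡ Σ[< m ] (λ a → Σ[< m ] (λ b → Σ[< n ] (λ i → Σ[< n ] (λ j → X i j a b))))
Σ²-interchange m n X = begin
  Σ[< n ] (λ i → Σ[< n ] (λ j → Σ[< m ] (λ a → Σ[< m ] (λ b → X i j a b))))
    ≡⟨ Σ-cong n (λ i → Σ-swap n m _) ⟩
  Σ[< n ] (λ i → Σ[< m ] (λ a → Σ[< n ] (λ j → Σ[< m ] (λ b → X i j a b))))
    ≡⟨ Σ-cong n (λ i → Σ-cong m (λ a → Σ-swap n m _)) ⟩
  Σ[< n ] (λ i → Σ[< m ] (λ a → Σ[< m ] (λ b → Σ[< n ] (λ j → X i j a b))))
    ≡⟨ Σ-swap n m _ ⟩
  Σ[< m ] (λ a → Σ[< n ] (λ i → Σ[< m ] (λ b → Σ[< n ] (λ j → X i j a b))))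
    ≡⟨ Σ-cong m (λ a → Σ-swap n m _) ⟩
  Σ[< m ] (λ a → Σ[< m ] (λ b → Σ[< n ] (λ i → Σ[< n ] (λ j → X i j a b)))) ∎
  where open ≡-Reasoning

Σ-const : ∀ n c → Σ[< n ] (λ _ → c) ≡ + n *ℤ c
Σ-const zero c = refl
Σ-const (suc n) c = begin
  c +ℤ Σ[< n ] (λ _ → c)  ≡⟨ cong₂ _+ℤ_ (sym (ZP.*-identityˡ c)) (Σ-const n c) ⟩
  1ℤ *ℤ c +ℤ + n *ℤ c     ≡⟨ sym (ZP.*-distribʳ-+ c 1ℤ (+ n)) ⟩
  + suc n *ℤ c            ∎
  where open ≡-Reasoning

Σ-single : ∀ n (f : Fin n → ℤ) (i : Fin n) → (∀ j → j ≢ i → f j ≡ 0ℤ) → Σ[< n ] f ≡ f i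
Σ-single (suc n) f zero vanish = begin
  f zero +ℤ Σ[< n ] (f ∘ suc)       ≡⟨ cong (f zero +ℤ_) (Σ-cong n (λ j → vanish (suc j) (λ ()))) ⟩
  f zero +ℤ Σ[< n ] (λ _ → 0ℤ)      ≡⟨ cong (f zero +ℤ_) (trans (Σ-const n 0ℤ) (ZP.*-zeroʳ (+ n))) ⟩
  f zero +ℤ 0ℤ                      ≡⟨ ZP.+-identityʳ (f zero) ⟩
  f zero                            ∎
  where open ≡-Reasoning
Σ-single (suc n) f (suc i) vanish =
  trans (cong₂ _+ℤ_ (vanish zero (λ ()))
                    (Σ-single n (f ∘ suc) i (λ j j≢i → vanish (suc j) (j≢i ∘ FP.suc-injective))))
        (ZP.+-identityˡ (f (suc i)))

Σ-remove : ∀ n (f : Fin (suc n) → ℤ) (i : Fin (suc n)) →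
  Σ[< suc n ] f ≡ f i +ℤ Σ[< n ] (f ∘ punchIn i)
Σ-remove n f i = trans (Σ≡sum (suc n) f)
  (trans (sum-remove f) (cong (f i +ℤ_) (sym (Σ≡sum n _))))

Σ-++ : ∀ n k (f : Fin (n + k) → ℤ) →
  Σ[< n + k ] f ≡ Σ[< n ] (λ i → f (i ↑ˡ k)) +ℤ Σ[< k ] (λ j → f (n ↑ʳ j))
Σ-++ zero k f = sym (ZP.+-identityˡ _)
Σ-++ (suc n) k f = trans (cong (f zero +ℤ_) (Σ-++ n k (f ∘ suc)))
  (sym (ZP.+-assoc (f zero) _ _))

Σ-combine : ∀ m n (f : Fin (m * n) → ℤ) →
  Σ[< m * n ] f ≡ Σ[< m ] (λ i → Σ[< n ] (λ j → f (combine i j)))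
Σ-combine zero n f = refl
Σ-combine (suc m) n f = trans (Σ-++ n (m * n) f)
  (cong (Σ[< n ] (λ j → f (j ↑ˡ (m * n))) +ℤ_) (Σ-combine m n (λ x → f (n ↑ʳ x))))

Σ-nonneg : ∀ n (f : Fin n → ℤ) → (∀ i → 0ℤ ≤ℤ f i) → 0ℤ ≤ℤ Σ[< n ] f
Σ-nonneg zero f f≥0 = +≤+ z≤n
Σ-nonneg (suc n) f f≥0 = ZP.+-mono-≤ (f≥0 zero) (Σ-nonneg n (f ∘ suc) (f≥0 ∘ suc))

Σ≡0⇒terms≡0 : ∀ n (f : Fin n → ℤ) → (∀ i → 0ℤ ≤ℤ f i) → Σ[< n ] f ≡ 0ℤ → ∀ i → f i ≡ 0ℤ
Σ≡0⇒terms≡0 (suc n) f f≥0 e i with nonneg-sum≡0 (f≥0 zero) (Σ-nonneg n (f ∘ suc) (f≥0 ∘ suc)) e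
Σ≡0⇒terms≡0 (suc n) f f≥0 e zero    | f0≡0 , _ = f0≡0
Σ≡0⇒terms≡0 (suc n) f f≥0 e (suc i) | _ , rest≡0 = Σ≡0⇒terms≡0 n (f ∘ suc) (f≥0 ∘ suc) rest≡0 i

-- G = c·I.  With this, IsHadamard n H is IsPM1 H × IsScalar (rowInner H) (+ n).
IsScalar : ∀ {n} → (Fin n → Fin n → ℤ) → ℤ → Set
IsScalar G c = ∀ i j → (i ≡ j → G i j ≡ c) × (i ≢ j → G i j ≡ + 0)

sumSq : ∀ {n} → (Fin n → Fin n → ℤ) → ℤ
sumSq {n} G = Σ[< n ] (λ i → Σ[< n ] (λ j → sq (G i j)))

-- ‖Mᵀ M‖² = ‖M Mᵀ‖²  (both equal trace (Mᵀ M Mᵀ M)), for any rectangular M.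
sumSq-colInner≡sumSq-rowInner : ∀ {m n} (M : Matrix m n) →
  sumSq (colInner M) ≡ sumSq (rowInner M)
sumSq-colInner≡sumSq-rowInner {m} {n} M = begin
  Σ[< n ] (λ i → Σ[< n ] (λ j → sq (colInner M i j)))
    ≡⟨ Σ-cong n (λ i → Σ-cong n (λ j → Σ-product m m _ _)) ⟩
  Σ[< n ] (λ i → Σ[< n ] (λ j → Σ[< m ] (λ a → Σ[< m ] (λ b →
    (M a i *ℤ M a j) *ℤ (M b i *ℤ M b j)))))
    ≡⟨ Σ²-interchange m n _ ⟩
  Σ[< m ] (λ a → Σ[< m ] (λ b → Σ[< n ] (λ i → Σ[< n ] (λ j →
    (M a i *ℤ M a j) *ℤ (M b i *ℤ M b j)))))
    ≡⟨ Σ-cong m (λ a → Σ-cong m (λ b → Σ-cong n (λ i → Σ-cong n (λ j →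
         interchange (M a i) (M a j) (M b i) (M b j))))) ⟩
  Σ[< m ] (λ a → Σ[< m ] (λ b → Σ[< n ] (λ i → Σ[< n ] (λ j →
    (M a i *ℤ M b i) *ℤ (M a j *ℤ M b j)))))
    ≡⟨ sym (Σ-cong m (λ a → Σ-cong m (λ b → Σ-product n n _ _))) ⟩
  Σ[< m ] (λ a → Σ[< m ] (λ b → sq (rowInner M a b))) ∎
  where open ≡-Reasoning

sumSq-scalar : ∀ {n} (G : Fin n → Fin n → ℤ) c → IsScalar G c → sumSq G ≡ + n *ℤ sq c
sumSq-scalar {n} G c G≡cI = begin
  Σ[< n ] (λ i → Σ[< n ] (λ j → sq (G i j)))
    ≡⟨ Σ-cong n (λ i → Σ-single n _ i (λ j j≢i → cong sq (proj₂ (G≡cI i j) (j≢i ∘ sym)))) ⟩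
  Σ[< n ] (λ i → sq (G i i))
    ≡⟨ Σ-cong n (λ i → cong sq (proj₁ (G≡cI i i) refl)) ⟩
  Σ[< n ] (λ _ → sq c)
    ≡⟨ Σ-const n (sq c) ⟩
  + n *ℤ sq c ∎
  where open ≡-Reasoning

sumSq-diagonal+offDiagonal : ∀ {n} (G : Fin (suc n) → Fin (suc n) → ℤ) c →
  (∀ i → G i i ≡ c) →
  sumSq G ≡ + suc n *ℤ sq c +ℤ Σ[< suc n ] (λ i → Σ[< n ] (λ k → sq (G i (punchIn i k))))
sumSq-diagonal+offDiagonal {n} G c diag≡c = begin
  Σ[< suc n ] (λ i → Σ[< suc n ] (λ j → sq (G i j)))
    ≡⟨ Σ-cong (suc n) (λ i → Σ-remove n (λ j → sq (G i j)) i) ⟩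
  Σ[< suc n ] (λ i → sq (G i i) +ℤ Σ[< n ] (λ k → sq (G i (punchIn i k))))
    ≡⟨ Σ-+ (suc n) (λ i → sq (G i i)) (λ i → Σ[< n ] (λ k → sq (G i (punchIn i k)))) ⟩
  Σ[< suc n ] (λ i → sq (G i i)) +ℤ Σ[< suc n ] (λ i → Σ[< n ] (λ k → sq (G i (punchIn i k))))
    ≡⟨ cong (_+ℤ _) (trans (Σ-cong (suc n) (cong sq ∘ diag≡c)) (Σ-const (suc n) (sq c))) ⟩
  + suc n *ℤ sq c +ℤ Σ[< suc n ] (λ i → Σ[< n ] (λ k → sq (G i (punchIn i k)))) ∎
  where open ≡-Reasoning

-- Converse of sumSq-scalar: constant diagonal c and ‖G‖² = n·c² force G = c·I,
-- since the remaining off-diagonal squares are non-negative and sum to 0.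
scalar-from-sumSq : ∀ {n} (G : Fin n → Fin n → ℤ) c →
  (∀ i → G i i ≡ c) → sumSq G ≡ + n *ℤ sq c → IsScalar G c
scalar-from-sumSq {suc n} G c diag≡c norm≡ i j = (λ { refl → diag≡c i }) , offDiagonal
  where
  offSq : Fin (suc n) → Fin n → ℤ
  offSq i k = sq (G i (punchIn i k))

  offSq-sum≡0 : Σ[< suc n ] (λ i → Σ[< n ] (offSq i)) ≡ 0ℤ
  offSq-sum≡0 = ∙-cancelˡ (+ suc n *ℤ sq c) _ 0ℤ
    (trans (sym (sumSq-diagonal+offDiagonal G c diag≡c))
           (trans norm≡ (sym (ZP.+-identityʳ _))))

  offSq≡0 : ∀ i k → offSq i k ≡ 0ℤ
  offSq≡0 i = Σ≡0⇒terms≡0 n (offSq i) (λ k → sq-nonneg (G i (punchIn i k)))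
    (Σ≡0⇒terms≡0 (suc n) _ (λ i → Σ-nonneg n (offSq i) (λ k → sq-nonneg (G i (punchIn i k)))) offSq-sum≡0 i)

  offDiagonal : i ≢ j → G i j ≡ + 0
  offDiagonal i≢j = sq≡0⇒≡0 (G i j)
    (subst (λ j′ → sq (G i j′) ≡ 0ℤ) (FP.punchIn-punchOut i≢j) (offSq≡0 i (punchOut i≢j)))

colInner-diagonal : ∀ {m n} (M : Matrix m n) → IsPM1 M → ∀ j → colInner M j j ≡ + m
colInner-diagonal {m} M ±M j =
  trans (Σ-cong m (λ a → ±1-square (±M a j)))
        (trans (Σ-const m 1ℤ) (ZP.*-identityʳ (+ m)))

hadamard-columns : ∀ {n} (H : Matrix n n) → IsHadamard n H → IsScalar (colInner H) (+ n)
hadamard-columns {n} H (±H , rows) =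
  scalar-from-sumSq (colInner H) (+ n) (colInner-diagonal H ±H)
    (trans (sumSq-colInner≡sumSq-rowInner H) (sumSq-scalar (rowInner H) (+ n) rows))

kronecker-scalar : ∀ {N k l} (p : Fin N → Fin k) (q : Fin N → Fin l) →
  (∀ r r′ → p r ≡ p r′ → q r ≡ q r′ → r ≡ r′) →
  ∀ {G G′ c c′} → IsScalar G c → IsScalar G′ c′ →
  IsScalar (λ r r′ → G (p r) (p r′) *ℤ G′ (q r) (q r′)) (c *ℤ c′)
kronecker-scalar p q injective {G} {G′} G≡cI G′≡c′I r r′ =
  (λ { refl → cong₂ _*ℤ_ (proj₁ (G≡cI (p r) (p r)) refl) (proj₁ (G′≡c′I (q r) (q r)) refl) })
  , offDiagonal (p r ≟ p r′) (q r ≟ q r′)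
  where
  offDiagonal : Dec (p r ≡ p r′) → Dec (q r ≡ q r′) →
    r ≢ r′ → G (p r) (p r′) *ℤ G′ (q r) (q r′) ≡ + 0
  offDiagonal (no p≢) _ _ =
    trans (cong (_*ℤ G′ (q r) (q r′)) (proj₂ (G≡cI (p r) (p r′)) p≢))
          (ZP.*-zeroˡ (G′ (q r) (q r′)))
  offDiagonal (yes _) (no q≢) _ =
    trans (cong (G (p r) (p r′) *ℤ_) (proj₂ (G′≡c′I (q r) (q r′)) q≢))
          (ZP.*-zeroʳ (G (p r) (p r′)))
  offDiagonal (yes p≡) (yes q≡) r≢r′ = ⊥-elim (r≢r′ (injective r r′ p≡ q≡))

-- The construction, for a square matrix H of positive order m = suc k (so that
-- the reference column 0 exists).  An index r : Fin (m * m) encodes the pair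
-- (hi r, lo r), and
--   K[r, s] = H[hi s, lo r] · H[lo s, hi r] · H[lo s, 0].
module SquareConstruction {k : ℕ} (H : Matrix (suc k) (suc k)) where

  m : ℕ
  m = suc k

  hi lo : Fin (m * m) → Fin m
  hi r = proj₁ (remQuot {m} m r)
  lo r = proj₂ (remQuot {m} m r)

  hi-combine : ∀ c d → hi (combine c d) ≡ c
  hi-combine c d = cong proj₁ (FP.remQuot-combine {m} {m} c d)

  lo-combine : ∀ c d → lo (combine c d) ≡ d
  lo-combine c d = cong proj₂ (FP.remQuot-combine {m} {m} c d)

  hi-lo-injective : ∀ r r′ → hi r ≡ hi r′ → lo r ≡ lo r′ → r ≡ r′
  hi-lo-injective r r′ hi≡ lo≡ = trans (sym (FP.combine-remQuot {m} m r))
    (trans (cong₂ combine hi≡ lo≡) (FP.combine-remQuot {m} m r′))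

  K : Matrix (m * m) (m * m)
  K r s = H (hi s) (lo r) *ℤ (H (lo s) (hi r) *ℤ H (lo s) zero)

  K-±1 : IsPM1 H → IsPM1 K
  K-±1 ±H r s = ±1-mul (±H _ _) (±1-mul (±H _ _) (±H _ _))

  -- The sign H[d, 0] appears in both factors and cancels.
  K-column-product : IsPM1 H → ∀ r r′ c d →
    K r (combine c d) *ℤ K r′ (combine c d)
    ≡ (H c (lo r) *ℤ H c (lo r′)) *ℤ (H d (hi r) *ℤ H d (hi r′))
  K-column-product ±H r r′ c d
    rewrite hi-combine c d | lo-combine c d = begin
    (x *ℤ (y *ℤ z)) *ℤ (x′ *ℤ (y′ *ℤ z))   ≡⟨ interchange x (y *ℤ z) x′ (y′ *ℤ z) ⟩
    (x *ℤ x′) *ℤ ((y *ℤ z) *ℤ (y′ *ℤ z))   ≡⟨ cong (x *ℤ x′ *ℤ_) (interchange y z y′ z) ⟩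
    (x *ℤ x′) *ℤ ((y *ℤ y′) *ℤ sq z)       ≡⟨ cong (x *ℤ x′ *ℤ_) (±1-absorb (y *ℤ y′) (±H d zero)) ⟩
    (x *ℤ x′) *ℤ (y *ℤ y′)                 ∎
    where
    open ≡-Reasoning
    x x′ y y′ z : ℤ
    x = H c (lo r)
    x′ = H c (lo r′)
    y = H d (hi r)
    y′ = H d (hi r′)
    z = H d zero

  K-rowInner : IsPM1 H → ∀ r r′ →
    rowInner K r r′ ≡ colInner H (lo r) (lo r′) *ℤ colInner H (hi r) (hi r′)
  K-rowInner ±H r r′ = begin
    Σ[< m * m ] (λ s → K r s *ℤ K r′ s)
      ≡⟨ Σ-combine m m (λ s → K r s *ℤ K r′ s) ⟩
    Σ[< m ] (λ c → Σ[< m ] (λ d → K r (combine c d) *ℤ K r′ (combine c d)))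
      ≡⟨ Σ-cong m (λ c → Σ-cong m (λ d → K-column-product ±H r r′ c d)) ⟩
    Σ[< m ] (λ c → Σ[< m ] (λ d → (H c (lo r) *ℤ H c (lo r′)) *ℤ (H d (hi r) *ℤ H d (hi r′))))
      ≡⟨ sym (Σ-product m m (λ c → H c (lo r) *ℤ H c (lo r′)) (λ d → H d (hi r) *ℤ H d (hi r′))) ⟩
    colInner H (lo r) (lo r′) *ℤ colInner H (hi r) (hi r′) ∎
    where open ≡-Reasoning

  K-hadamard : IsHadamard m H → IsHadamard (m * m) K
  K-hadamard hadH@(±H , _) = K-±1 ±H , λ r r′ →
    let (diagonal , offDiagonal) = kronecker-scalar lo hi
          (λ r r′ lo≡ hi≡ → hi-lo-injective r r′ hi≡ lo≡) columns columns r r′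
    in (λ r≡r′ → trans (K-rowInner ±H r r′) (trans (diagonal r≡r′) (sym (ZP.pos-* m m))))
       , (λ r≢r′ → trans (K-rowInner ±H r r′) (offDiagonal r≢r′))
    where
    columns : IsScalar (colInner H) (+ m)
    columns = hadamard-columns H hadH

  m≤m*m : m ≤ m * m
  m≤m*m = m≤m*n m m

  topRow-index : ∀ i → inject≤ i m≤m*m ≡ combine {m} {m} zero i
  topRow-index i = FP.toℕ-injective
    (trans (FP.toℕ-inject≤ i m≤m*m) (sym (FP.toℕ-↑ˡ {m} i (k * m))))

  topRows : Matrix m (m * m)
  topRows i = K (inject≤ i m≤m*m)

  topRows-entry : IsPM1 H → ∀ i s → topRows i s ≡ H (hi s) i
  topRows-entry ±H i s rewrite topRow-index i | hi-combine zero i | lo-combine zero i =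
    ±1-absorb (H (hi s) i) (±H (lo s) zero)

  topRows-colInner : IsPM1 H → ∀ s s′ → colInner topRows s s′ ≡ rowInner H (hi s) (hi s′)
  topRows-colInner ±H s s′ =
    Σ-cong m (λ i → cong₂ _*ℤ_ (topRows-entry ±H i s) (topRows-entry ±H i s′))

𝟙 : ∀ {p} {P : Set p} → Dec P → ℕ
𝟙 (yes _) = 1
𝟙 (no _) = 0

𝟙-cong : ∀ {p q} {P : Set p} {Q : Set q} → (P → Q) → (Q → P) →
  (P? : Dec P) (Q? : Dec Q) → 𝟙 P? ≡ 𝟙 Q?
𝟙-cong P→Q Q→P (yes _) (yes _) = refl
𝟙-cong P→Q Q→P (yes p) (no ¬q) = ⊥-elim (¬q (P→Q p))
𝟙-cong P→Q Q→P (no ¬p) (yes q) = ⊥-elim (¬p (Q→P q))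
𝟙-cong P→Q Q→P (no _) (no _) = refl

𝟙-no : ∀ {p} {P : Set p} → ¬ P → (P? : Dec P) → 𝟙 P? ≡ 0
𝟙-no ¬p (yes p) = ⊥-elim (¬p p)
𝟙-no ¬p (no _) = refl

𝟙≡1⇒ : ∀ {p} {P : Set p} (P? : Dec P) → 𝟙 P? ≡ 1 → P
𝟙≡1⇒ (yes p) _ = p

𝟙≡0⇒¬ : ∀ {p} {P : Set p} (P? : Dec P) → 𝟙 P? ≡ 0 → ¬ P
𝟙≡0⇒¬ (no ¬p) _ = ¬p

sameBlock : ∀ {N k} → (Fin N → Fin k) → Fin N → Fin N → ℕ
sameBlock f s t = 𝟙 (f s ≟ f t ×-dec ¬? (s ≟ t))

sameBlock-isAdjacency : ∀ {N k} (f : Fin N → Fin k) → IsAdjacency (sameBlock f)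
sameBlock-isAdjacency f = zeroOrOne , symmetric , irreflexive
  where
  zeroOrOne : ∀ s t → (sameBlock f s t ≡ 0) ⊎ (sameBlock f s t ≡ 1)
  zeroOrOne s t with f s ≟ f t ×-dec ¬? (s ≟ t)
  ... | yes _ = inj₂ refl
  ... | no _ = inj₁ refl

  symmetric : ∀ s t → sameBlock f s t ≡ sameBlock f t s
  symmetric s t = 𝟙-cong flip flip _ _
    where
    flip : ∀ {s t} → (f s ≡ f t) × (s ≢ t) → (f t ≡ f s) × (t ≢ s)
    flip (same , distinct) = sym same , distinct ∘ sym

  irreflexive : ∀ s → sameBlock f s s ≡ 0
  irreflexive s = 𝟙-no (λ { (_ , s≢s) → s≢s refl }) _

blockGram-condition : ∀ {ℓ N k} (H₁ : Matrix ℓ N) (f : Fin N → Fin k)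
  (R : Fin k → Fin k → ℤ) → IsScalar R (+ ℓ) →
  (∀ s t → colInner H₁ s t ≡ R (f s) (f t)) →
  GramCondition H₁ ℓ (+ ℓ) (+ 0) (sameBlock f)
blockGram-condition H₁ f R R≡ℓI gram s t =
  (λ { refl → trans (gram s s) (proj₁ (R≡ℓI (f s) (f s)) refl) })
  , (λ _ adjacent →
       trans (gram s t) (proj₁ (R≡ℓI (f s) (f t)) (proj₁ (𝟙≡1⇒ (f s ≟ f t ×-dec ¬? (s ≟ t)) adjacent))))
  , (λ s≢t nonAdjacent →
       trans (gram s t) (proj₂ (R≡ℓI (f s) (f t))
         (λ same → 𝟙≡0⇒¬ (f s ≟ f t ×-dec ¬? (s ≟ t)) nonAdjacent (same , s≢t))))

theorem3p2 : (m : ℕ) → .{{_ : NonZero m}} → HadamardExists m →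
    Σ (Matrix (m * m) (m * m)) λ H →
    IsHadamard (m * m) H × BalancedlySplittable (m * m) H m (+ m) (+ 0)
theorem3p2 (suc k) (H , hadH@(±H , rows)) =
  K , K-hadamard hadH ,
  m≤m*m , id , sameBlock hi , sameBlock-isAdjacency hi ,
  blockGram-condition topRows hi (rowInner H) rows (topRows-colInner ±H)
  where open SquareConstruction H
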